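{- Let $n\ge1$, $A=(a_{i,j})_{1\le i,j\le n}$, and let $\lambda=(\lambda_a)_{a\in\mathbb Z}$, $\mu=(\mu_a)_{a\in\mathbb Z}$ be parameters. Define $\sigma(A)_{i,j}=a_{n+1-j,i}$ (quarter-turn rotation) and $\tau(A)_{i,j}=a_{j,i}$ (transposition), and on parameters $\sigma(\lambda)_a=\mu_{ -a}$, $\sigma(\mu)_a=\lambda_a$, $\tau(\lambda)_a=\lambda_{ -a}$, $\tau(\mu)_a=\mu_a$. Then for $\varphi\in\{\sigma,\tau\}$, $$|\varphi(A)|_{\varphi(\lambda),\varphi(\mu)}=|A|_{\lambda,\mu}.$$
   Context: Generalized Lambda-determinant: given $A=(a_{r,c})_{1\le r,c\le n}$ and parameters $(\lambda_a),(\mu_a)$, define $T_{i,j,k}$ for $i,j\in\mathbb Z$, $k\ge 0$, $i+j+k\equiv n \pmod 2$, by $T_{i,j,0}=1$ ($i+j\equiv n$ mod 2), $T_{i,j,1}=a_{\frac{j-i+n+1}{2},\frac{i+j+n+1}{2}}$ ($i+j\equiv n+1$ mod 2, $|i|+|j|\le n-1$), and $T_{i,j,k+1}T_{i,j,k-1}=\mu_j\,T_{i,j+1,k}T_{i,j-1,k}+\lambda_i\,T_{i+1,j,k}T_{i-1,j,k}$. Then $|A|_{\lambda,\mu}:=T_{0,0,n}$ (determined by the data with $|i|+|j|\le n-1$; entries are taken generic/indeterminate so all divisions make sense). -}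

module Defs where

open import Level using (Level; _⊔_) renaming (suc to lsuc)
open import Algebra.Bundles using (CommutativeRing)
open import Relation.Nullary using (¬_; yes; no)
open import Data.Nat as ℕ using (ℕ; zero; suc)
open import Data.Integer as ℤ using (ℤ; +_; _/ℕ_)
open import Data.Fin using (Fin; fromℕ<; opposite)
open import Data.Integer.Divisibility as ℤD using ()
open import Data.Maybe using (Maybe; just; nothing)

-- A field: a commutative ring with 1 ≠ 0 in which every nonzero element
-- has a multiplicative inverse.  The inverse is given as a total function
-- (its value at 0 is irrelevant / unconstrained).
record Field (c ℓ : Level) : Set (lsuc (c ⊔ ℓ)) where
  field
    commutativeRing : CommutativeRing c ℓ
  open CommutativeRing commutativeRing public
  field
    _⁻¹       : Carrier → Carrier
    1≉0       : ¬ (1# ≈ 0#)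
    ⁻¹-inverse : ∀ x → ¬ (x ≈ 0#) → (x * (x ⁻¹)) ≈ 1#

toFin : (n : ℕ) → ℤ → Maybe (Fin n)
toFin n (+ m) with m ℕ.<? n
... | yes p = just (fromℕ< p)
... | no _  = nothing
toFin n ℤ.-[1+ _ ] = nothing

module LambdaDet {c ℓ} (F : Field c ℓ) where
  open Field F

  -- Matrices are 0-indexed: A r c = a_{r+1,c+1}.
  Matrix : ℕ → Set c
  Matrix n = Fin n → Fin n → Carrier

  -- T_{i,j,1} = a_{(j-i+n+1)/2, (i+j+n+1)/2}  (1-based), i.e. 0-based row
  -- (j-i+n-1)/2 and column (i+j+n-1)/2.  Only used at points with the right
  -- parity and |i|+|j| ≤ n-1, where these indices are exact and in range;
  -- elsewhere the value 0 is an irrelevant filler.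
  entry : (n : ℕ) → Matrix n → ℤ → ℤ → Carrier
  entry n A i j with toFin n ((j ℤ.- i ℤ.+ + n ℤ.- + 1) /ℕ 2)
                   | toFin n ((i ℤ.+ j ℤ.+ + n ℤ.- + 1) /ℕ 2)
  ... | just r  | just c' = A r c'
  ... | _       | _       = 0#

  -- T n A λ μ k i j = T_{i,j,k}, computed by the octahedron recurrence
  --   T_{i,j,k+1} = (μ_j T_{i,j+1,k} T_{i,j-1,k} + λ_i T_{i+1,j,k} T_{i-1,j,k}) / T_{i,j,k-1}.
  -- (Defined at every (i,j,k); only points with i+j+k ≡ n mod 2 are meaningful.)
  T : (n : ℕ) → Matrix n → (ℤ → Carrier) → (ℤ → Carrier) → ℕ → ℤ → ℤ → Carrier
  T n A λ' μ' zero          i j = 1#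
  T n A λ' μ' (suc zero)    i j = entry n A i j
  T n A λ' μ' (suc (suc k)) i j =
    ((μ' j * (T n A λ' μ' (suc k) i (j ℤ.+ + 1) * T n A λ' μ' (suc k) i (j ℤ.- + 1)))
     + (λ' i * (T n A λ' μ' (suc k) (i ℤ.+ + 1) j * T n A λ' μ' (suc k) (i ℤ.- + 1) j)))
    * (T n A λ' μ' k i j ⁻¹)

  ldet : (n : ℕ) → Matrix n → (ℤ → Carrier) → (ℤ → Carrier) → Carrier
  ldet n A λ' μ' = T n A λ' μ' n (+ 0) (+ 0)

  -- Genericity: every denominator occurring in the computation of T_{0,0,n}
  -- is nonzero.  These are exactly the T_{i,j,k} with k ≥ 1,
  -- |i|+|j|+k ≤ n-2 and i+j+k ≡ n (mod 2).
  Generic : (n : ℕ) → Matrix n → (ℤ → Carrier) → (ℤ → Carrier) → Set ℓ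
  Generic n A λ' μ' = ∀ (i j : ℤ) (k : ℕ) → 1 ℕ.≤ k →
    ℤ.∣ i ∣ ℕ.+ ℤ.∣ j ∣ ℕ.+ k ℕ.≤ n ℕ.∸ 2 →
    (+ 2) ℤD.∣ (i ℤ.+ j ℤ.+ + k ℤ.- + n) →
    ¬ (T n A λ' μ' k i j ≈ 0#)

  σA : {n : ℕ} → Matrix n → Matrix n
  σA A r c' = A (opposite c') r
  τA : {n : ℕ} → Matrix n → Matrix n
  τA A r c' = A c' r
  σλ : (ℤ → Carrier) → (ℤ → Carrier) → (ℤ → Carrier)
  σλ λ' μ' a = μ' (ℤ.- a)
  σμ : (ℤ → Carrier) → (ℤ → Carrier) → (ℤ → Carrier)
  σμ λ' μ' a = λ' a
  τλ : (ℤ → Carrier) → (ℤ → Carrier) → (ℤ → Carrier)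
  τλ λ' μ' a = λ' (ℤ.- a)
  τμ : (ℤ → Carrier) → (ℤ → Carrier) → (ℤ → Carrier)
  τμ λ' μ' a = μ' a

-- σ and τ act on the lattice of the octahedron recurrence by (i, j, k) ↦ (j, −i, k) and
-- (i, j, k) ↦ (−i, j, k), fixing the apex (0, 0, n).  The transformed parameters are exactly
-- those for which the recurrence of the transformed data at (i, j, k) is, term by term, the
-- recurrence of the original data at the image point (for σ the λ- and μ-terms trade places),
-- and the transformed matrix has at (i, j, 1) the original entry at the image point.  Induction
-- on k over the pyramid |i| + |j| + k ≤ n below the apex therefore gives
-- T^φ_{i,j,k} = T_{φ(i,j),k}, and at the apex this is the claim.
module Submission where

open import Defs
open import Data.Nat as ℕ using (ℕ; zero; suc; _≤_; _<_; _<?_; s≤s; z≤n)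
import Data.Nat.Properties as ℕₚ
import Data.Nat.Divisibility as ℕ∣
open import Data.Nat.DivMod using (m*n/n≡m)
open import Data.Nat.Tactic.RingSolver as ℕSolver using ()
open import Data.Integer as ℤ using (ℤ; +_; -[1+_]; _/ℕ_)
import Data.Integer.Properties as ℤₚ
open import Data.Integer.Divisibility.Signed
  using (_∣_; divides; ∣⇒∣ᵤ; ∣-refl; ∣m∣n⇒∣m+n; ∣m∣n⇒∣m-n; ∣n⇒∣m*n)
open import Data.Integer.Tactic.RingSolver as ℤSolver using ()
open import Data.Fin using (Fin; fromℕ<; opposite; toℕ)
import Data.Fin.Properties as Finₚ
open import Data.Maybe using (Maybe; just; nothing)
import Data.Maybe as Maybe
open import Data.Product using (_×_; Σ-syntax; _,_; proj₁)
open import Data.Empty using (⊥-elim)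
open import Relation.Nullary using (¬_; yes; no)
open import Relation.Binary.PropositionalEquality
  using (_≡_; refl; sym; trans; cong; cong₂; subst; subst₂; module ≡-Reasoning)

-- The pyramid below the apex (0, 0, n): the points of the lattice on which T_{0,0,n} depends.
record Pyramid (n : ℕ) (i j : ℤ) (k : ℕ) : Set where
  constructor pyramid
  field
    size : k ℕ.+ (ℤ.∣ i ∣ ℕ.+ ℤ.∣ j ∣) ≤ n
    even : + 2 ∣ i ℤ.+ j ℤ.+ + k ℤ.- + n

data Adjacent (a : ℤ) : ℤ → Set where
  inc : Adjacent a (a ℤ.+ + 1)
  dec : Adjacent a (a ℤ.- + 1)

∣∣-adjacent : ∀ {a b} → Adjacent a b → ℤ.∣ b ∣ ≤ suc ℤ.∣ a ∣
∣∣-adjacent {a} inc =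
  ℕₚ.≤-trans (ℤₚ.∣i+j∣≤∣i∣+∣j∣ a (+ 1)) (ℕₚ.≤-reflexive (ℕₚ.+-comm ℤ.∣ a ∣ 1))
∣∣-adjacent {a} dec =
  ℕₚ.≤-trans (ℤₚ.∣i+j∣≤∣i∣+∣j∣ a (ℤ.- + 1)) (ℕₚ.≤-reflexive (ℕₚ.+-comm ℤ.∣ a ∣ 1))

adjacent-+ʳ : ∀ {i i′} j → Adjacent i i′ → Adjacent (i ℤ.+ j) (i′ ℤ.+ j)
adjacent-+ʳ {i} j inc = subst (Adjacent (i ℤ.+ j)) (shift i j) inc
  where
  shift : ∀ i j → i ℤ.+ j ℤ.+ + 1 ≡ i ℤ.+ + 1 ℤ.+ j
  shift = ℤSolver.solve-∀
adjacent-+ʳ {i} j dec = subst (Adjacent (i ℤ.+ j)) (shift i j) dec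
  where
  shift : ∀ i j → i ℤ.+ j ℤ.- + 1 ≡ i ℤ.- + 1 ℤ.+ j
  shift = ℤSolver.solve-∀

adjacent-+ˡ : ∀ i {j j′} → Adjacent j j′ → Adjacent (i ℤ.+ j) (i ℤ.+ j′)
adjacent-+ˡ i {j} inc = subst (Adjacent (i ℤ.+ j)) (ℤₚ.+-assoc i j (+ 1)) inc
adjacent-+ˡ i {j} dec = subst (Adjacent (i ℤ.+ j)) (ℤₚ.+-assoc i j (ℤ.- + 1)) dec

parity-descend : ∀ {s s′} k n → Adjacent s s′ →
  + 2 ∣ s ℤ.+ + suc (suc k) ℤ.- + n → + 2 ∣ s′ ℤ.+ + suc k ℤ.- + n
parity-descend {s} k n inc even = subst (+ 2 ∣_) (same s (+ k) (+ n)) even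
  where
  same : ∀ s K N → s ℤ.+ (+ 1 ℤ.+ (+ 1 ℤ.+ K)) ℤ.- N ≡ s ℤ.+ + 1 ℤ.+ (+ 1 ℤ.+ K) ℤ.- N
  same = ℤSolver.solve-∀
parity-descend {s} k n dec even = subst (+ 2 ∣_) (less s (+ k) (+ n)) (∣m∣n⇒∣m-n even ∣-refl)
  where
  less : ∀ s K N → s ℤ.+ (+ 1 ℤ.+ (+ 1 ℤ.+ K)) ℤ.- N ℤ.- + 2 ≡ s ℤ.- + 1 ℤ.+ (+ 1 ℤ.+ K) ℤ.- N
  less = ℤSolver.solve-∀

Pyramid-descend : ∀ {n i j i′ j′ k} →
  ℤ.∣ i′ ∣ ℕ.+ ℤ.∣ j′ ∣ ≤ suc (ℤ.∣ i ∣ ℕ.+ ℤ.∣ j ∣) → Adjacent (i ℤ.+ j) (i′ ℤ.+ j′) →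
  Pyramid n i j (suc (suc k)) → Pyramid n i′ j′ (suc k)
Pyramid-descend {n} {i} {j} {k = k} bound adjacent (pyramid size even) = pyramid
  (ℕₚ.≤-trans (s≤s (ℕₚ.+-monoʳ-≤ k bound))
    (ℕₚ.≤-trans (ℕₚ.≤-reflexive (cong suc (ℕₚ.+-suc k (ℤ.∣ i ∣ ℕ.+ ℤ.∣ j ∣)))) size))
  (parity-descend k n adjacent even)

Pyramid-neighbourⁱ : ∀ {n i i′ j k} → Adjacent i i′ →
  Pyramid n i j (suc (suc k)) → Pyramid n i′ j (suc k)
Pyramid-neighbourⁱ {j = j} adjacent =
  Pyramid-descend (ℕₚ.+-monoˡ-≤ ℤ.∣ j ∣ (∣∣-adjacent adjacent)) (adjacent-+ʳ j adjacent)

Pyramid-neighbourʲ : ∀ {n i j j′ k} → Adjacent j j′ →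
  Pyramid n i j (suc (suc k)) → Pyramid n i j′ (suc k)
Pyramid-neighbourʲ {i = i} {j} adjacent =
  Pyramid-descend
    (ℕₚ.≤-trans (ℕₚ.+-monoʳ-≤ ℤ.∣ i ∣ (∣∣-adjacent adjacent))
                (ℕₚ.≤-reflexive (ℕₚ.+-suc ℤ.∣ i ∣ ℤ.∣ j ∣)))
    (adjacent-+ˡ i adjacent)

Pyramid-below : ∀ {n i j k} → Pyramid n i j (suc (suc k)) → Pyramid n i j k
Pyramid-below {n} {i} {j} {k} (pyramid size even) = pyramid
  (ℕₚ.≤-trans (ℕₚ.m≤n+m (k ℕ.+ (ℤ.∣ i ∣ ℕ.+ ℤ.∣ j ∣)) 2) size)
  (subst (+ 2 ∣_) (less (i ℤ.+ j) (+ k) (+ n)) (∣m∣n⇒∣m-n even ∣-refl))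
  where
  less : ∀ s K N → s ℤ.+ (+ 1 ℤ.+ (+ 1 ℤ.+ K)) ℤ.- N ℤ.- + 2 ≡ s ℤ.+ K ℤ.- N
  less = ℤSolver.solve-∀

Pyramid-apex : ∀ n → Pyramid n (+ 0) (+ 0) n
Pyramid-apex n = pyramid (ℕₚ.≤-reflexive (ℕₚ.+-identityʳ n)) (divides (+ 0) (ℤₚ.+-inverseʳ (+ n)))

n+n≡n*2 : ∀ n → n ℕ.+ n ≡ n ℕ.* 2
n+n≡n*2 = ℕSolver.solve-∀

∣s∣≤n⇒s+n≡+t : ∀ s n → ℤ.∣ s ∣ ≤ n → Σ[ t ∈ ℕ ] (s ℤ.+ + n ≡ + t) × (t ≤ n ℕ.+ n)
∣s∣≤n⇒s+n≡+t (+ a)    n a≤n = a ℕ.+ n , refl , ℕₚ.+-monoˡ-≤ n a≤n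
∣s∣≤n⇒s+n≡+t -[1+ a ] n a<n =
  n ℕ.∸ suc a , ℤₚ.⊖-≥ a<n , ℕₚ.≤-trans (ℕₚ.m∸n≤m n (suc a)) (ℕₚ.m≤m+n n n)

halve : ∀ s n → ℤ.∣ s ∣ ≤ n → + 2 ∣ s ℤ.+ + n → Σ[ m ∈ ℕ ] (s ℤ.+ + n ≡ + (m ℕ.* 2)) × (m ≤ n)
halve s n bound even with ∣s∣≤n⇒s+n≡+t s n bound
... | t , s+n≡t , t≤n+n with ∣⇒∣ᵤ (subst (+ 2 ∣_) s+n≡t even)
... | ℕ∣.divides m t≡m*2 =
  m , trans s+n≡t (cong +_ t≡m*2) , ℕₚ.*-cancelʳ-≤ m n 2 (subst₂ _≤_ t≡m*2 (n+n≡n*2 n) t≤n+n)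

toFin-< : ∀ {m n} (m<n : m < n) → toFin n (+ m) ≡ just (fromℕ< m<n)
toFin-< {m} {n} m<n with m <? n
... | yes _   = refl
... | no  m≮n = ⊥-elim (m≮n m<n)

toFin-half : ∀ {m n} (m<n : m < n) → toFin n ((+ (m ℕ.* 2)) /ℕ 2) ≡ just (fromℕ< m<n)
toFin-half {m} {n} m<n = trans (cong (λ x → toFin n (+ x)) (m*n/n≡m m 2)) (toFin-< m<n)

opposite-fromℕ< : ∀ {m d n} (m<1+n : m < suc n) (d<1+n : d < suc n) →
  m ℕ.+ d ≡ n → opposite (fromℕ< m<1+n) ≡ fromℕ< d<1+n
opposite-fromℕ< {m} {d} m<1+n d<1+n m+d≡n = Finₚ.toℕ-injective (begin
  toℕ (opposite (fromℕ< m<1+n))  ≡⟨ Finₚ.opposite-prop (fromℕ< m<1+n) ⟩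
  _ ℕ.∸ toℕ (fromℕ< m<1+n)       ≡⟨ cong₂ ℕ._∸_ (sym m+d≡n) (Finₚ.toℕ-fromℕ< m<1+n) ⟩
  m ℕ.+ d ℕ.∸ m                  ≡⟨ ℕₚ.m+n∸m≡n m d ⟩
  d                              ≡⟨ Finₚ.toℕ-fromℕ< d<1+n ⟨
  toℕ (fromℕ< d<1+n)             ∎)
  where open ≡-Reasoning

parity-neg : ∀ s n → + 2 ∣ s ℤ.+ + n → + 2 ∣ ℤ.- s ℤ.+ + n
parity-neg s n even = subst (+ 2 ∣_) (sym (reflect s (+ n))) (∣m∣n⇒∣m-n even (∣n⇒∣m*n s ∣-refl))
  where
  reflect : ∀ s N → ℤ.- s ℤ.+ N ≡ s ℤ.+ N ℤ.- s ℤ.* + 2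
  reflect = ℤSolver.solve-∀

halves-sum : ∀ s n m d → s ℤ.+ + n ≡ + (m ℕ.* 2) → ℤ.- s ℤ.+ + n ≡ + (d ℕ.* 2) → m ℕ.+ d ≡ n
halves-sum s n m d s+n≡2m -s+n≡2d = ℕₚ.*-cancelʳ-≡ (m ℕ.+ d) n 2 (begin
  (m ℕ.+ d) ℕ.* 2      ≡⟨ ℕₚ.*-distribʳ-+ 2 m d ⟩
  m ℕ.* 2 ℕ.+ d ℕ.* 2  ≡⟨ ℤₚ.+-injective (trans (sym (cong₂ ℤ._+_ s+n≡2m -s+n≡2d)) (sum s (+ n))) ⟩
  n ℕ.+ n              ≡⟨ n+n≡n*2 n ⟩
  n ℕ.* 2              ∎)
  where
  open ≡-Reasoning
  sum : ∀ s N → s ℤ.+ N ℤ.+ (ℤ.- s ℤ.+ N) ≡ N ℤ.+ N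
  sum = ℤSolver.solve-∀

toFin-opposite : ∀ n s → ℤ.∣ s ∣ ≤ n → + 2 ∣ s ℤ.+ + n →
  toFin (suc n) ((ℤ.- s ℤ.+ + n) /ℕ 2) ≡ Maybe.map opposite (toFin (suc n) ((s ℤ.+ + n) /ℕ 2))
toFin-opposite n s bound even
  with m , s+n≡2m , m≤n ← halve s n bound even
     | d , -s+n≡2d , d≤n ← halve (ℤ.- s) n (subst (_≤ n) (sym (ℤₚ.∣-i∣≡∣i∣ s)) bound)
                                  (parity-neg s n even)
  = begin
    half (ℤ.- s ℤ.+ + n)                               ≡⟨ cong half -s+n≡2d ⟩
    half (+ (d ℕ.* 2))                                 ≡⟨ toFin-half (s≤s d≤n) ⟩
    just (fromℕ< (s≤s d≤n))                            ≡⟨ cong just opposite-m≡d ⟨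
    just (opposite (fromℕ< (s≤s m≤n)))                 ≡⟨ cong (Maybe.map opposite) (toFin-half (s≤s m≤n)) ⟨
    Maybe.map opposite (half (+ (m ℕ.* 2)))            ≡⟨ cong (λ x → Maybe.map opposite (half x)) s+n≡2m ⟨
    Maybe.map opposite (half (s ℤ.+ + n))              ∎
  where
  open ≡-Reasoning
  half : ℤ → Maybe (Fin (suc n))
  half x = toFin (suc n) (x /ℕ 2)
  opposite-m≡d : opposite (fromℕ< (s≤s m≤n)) ≡ fromℕ< (s≤s d≤n)
  opposite-m≡d = opposite-fromℕ< (s≤s m≤n) (s≤s d≤n) (halves-sum s n m d s+n≡2m -s+n≡2d)

toFin-opposite-layer₁ : ∀ {n i j} → Pyramid n i j 1 →
  toFin n ((ℤ.- i ℤ.- j ℤ.+ + n ℤ.- + 1) /ℕ 2)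
  ≡ Maybe.map opposite (toFin n ((i ℤ.+ j ℤ.+ + n ℤ.- + 1) /ℕ 2))
toFin-opposite-layer₁ {suc n} {i} {j} (pyramid (s≤s size) even) =
  subst₂ (λ x y → toFin (suc n) (x /ℕ 2) ≡ Maybe.map opposite (toFin (suc n) (y /ℕ 2)))
    (sym (reflected i j (+ n))) (sym (centred (i ℤ.+ j) (+ n)))
    (toFin-opposite n (i ℤ.+ j) (ℕₚ.≤-trans (ℤₚ.∣i+j∣≤∣i∣+∣j∣ i j) size) s+n-even)
  where
  reflected : ∀ i j N → ℤ.- i ℤ.- j ℤ.+ (+ 1 ℤ.+ N) ℤ.- + 1 ≡ ℤ.- (i ℤ.+ j) ℤ.+ N
  reflected = ℤSolver.solve-∀
  centred : ∀ s N → s ℤ.+ (+ 1 ℤ.+ N) ℤ.- + 1 ≡ s ℤ.+ N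
  centred = ℤSolver.solve-∀
  shifted : ∀ s N → s ℤ.+ N ≡ s ℤ.+ + 1 ℤ.- (+ 1 ℤ.+ N) ℤ.+ N ℤ.* + 2
  shifted = ℤSolver.solve-∀
  s+n-even : + 2 ∣ i ℤ.+ j ℤ.+ + n
  s+n-even = subst (+ 2 ∣_) (sym (shifted (i ℤ.+ j) (+ n))) (∣m∣n⇒∣m+n even (∣n⇒∣m*n (+ n) ∣-refl))

module _ {c ℓ} (F : Field c ℓ) where
  open Field F renaming (refl to ≈-refl; trans to ≈-trans)
  open LambdaDet F

  ⁻¹-cong : ∀ {x y} → x ≈ y → ¬ (x ≈ 0#) → x ⁻¹ ≈ y ⁻¹
  ⁻¹-cong {x} {y} x≈y x≉0 = begin
    x ⁻¹                ≈⟨ *-identityʳ _ ⟨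
    x ⁻¹ * 1#           ≈⟨ *-congˡ (⁻¹-inverse y y≉0) ⟨
    x ⁻¹ * (y * y ⁻¹)   ≈⟨ *-assoc _ _ _ ⟨
    x ⁻¹ * y * y ⁻¹     ≈⟨ *-congʳ (*-congˡ x≈y) ⟨
    x ⁻¹ * x * y ⁻¹     ≈⟨ *-congʳ (*-comm _ _) ⟩
    x * x ⁻¹ * y ⁻¹     ≈⟨ *-congʳ (⁻¹-inverse x x≉0) ⟩
    1# * y ⁻¹           ≈⟨ *-identityˡ _ ⟩
    y ⁻¹                ∎
    where
    open import Relation.Binary.Reasoning.Setoid setoid
    y≉0 : ¬ (y ≈ 0#)
    y≉0 y≈0 = x≉0 (≈-trans x≈y y≈0)

  -- T (2 + k) i j reduces to  numerator … k i j * T k i j ⁻¹.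
  numerator : (n : ℕ) → Matrix n → (ℤ → Carrier) → (ℤ → Carrier) → ℕ → ℤ → ℤ → Carrier
  numerator n A λ' μ' k i j =
    μ' j * (T′ i (j ℤ.+ + 1) * T′ i (j ℤ.- + 1)) + λ' i * (T′ (i ℤ.+ + 1) j * T′ (i ℤ.- + 1) j)
    where
    T′ : ℤ → ℤ → Carrier
    T′ = T n A λ' μ' (suc k)

  Generic⇒T≉0 : ∀ {n A λ' μ' i j k} → Generic n A λ' μ' →
    Pyramid n i j (suc (suc k)) → ¬ (T n A λ' μ' k i j ≈ 0#)
  Generic⇒T≉0 {k = zero} _ _ = 1≉0
  Generic⇒T≉0 {i = i} {j} {suc k} generic p@(pyramid (s≤s (s≤s size)) _) =
    generic i j (suc k) (s≤s z≤n)
      (ℕₚ.≤-trans (ℕₚ.≤-reflexive (ℕₚ.+-comm (ℤ.∣ i ∣ ℕ.+ ℤ.∣ j ∣) (suc k))) size)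
      (∣⇒∣ᵤ (Pyramid.even (Pyramid-below p)))

  module Transport {n : ℕ} (B A : Matrix n) (λᴮ μᴮ λᴬ μᴬ : ℤ → Carrier) (ψᵢ ψⱼ : ℤ → ℤ → ℤ) where

    Agree : ℕ → Set ℓ
    Agree k = ∀ i j → Pyramid n i j k → T n B λᴮ μᴮ k i j ≈ T n A λᴬ μᴬ k (ψᵢ i j) (ψⱼ i j)

    agree-at-apex : Generic n B λᴮ μᴮ → Agree 1 →
      (∀ k i j → Pyramid n i j (suc (suc k)) → Agree (suc k) →
        numerator n B λᴮ μᴮ k i j ≈ numerator n A λᴬ μᴬ k (ψᵢ i j) (ψⱼ i j)) →
      T n B λᴮ μᴮ n (+ 0) (+ 0) ≈ T n A λᴬ μᴬ n (ψᵢ (+ 0) (+ 0)) (ψⱼ (+ 0) (+ 0))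
    agree-at-apex generic layer₁ numerators = proj₁ (agree-layers n) (+ 0) (+ 0) (Pyramid-apex n)
      where
      agree-layers : ∀ k → Agree k × Agree (suc k)
      agree-layers zero    = (λ _ _ _ → ≈-refl) , layer₁
      agree-layers (suc k) with agree₀ , agree₁ ← agree-layers k =
        agree₁ , λ i j p →
          *-cong (numerators k i j p agree₁)
                 (⁻¹-cong (agree₀ i j (Pyramid-below p)) (Generic⇒T≉0 generic p))

  reflected-neighbours : ∀ (f : ℤ → Carrier) i →
    f (ℤ.- (i ℤ.+ + 1)) * f (ℤ.- (i ℤ.- + 1)) ≈ f (ℤ.- i ℤ.+ + 1) * f (ℤ.- i ℤ.- + 1)
  reflected-neighbours f i =
    ≈-trans (*-comm _ _)
      (reflexive (cong₂ _*_ (cong f (ℤₚ.neg-distrib-+ i (ℤ.- + 1))) (cong f (ℤₚ.neg-distrib-+ i (+ 1)))))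

  partialEntry : ∀ {n} → Matrix n → Maybe (Fin n) → Maybe (Fin n) → Carrier
  partialEntry A (just r) (just c′) = A r c′
  partialEntry A _        _         = 0#

  entry≡partialEntry : ∀ n A i j → entry n A i j ≡
    partialEntry A (toFin n ((j ℤ.- i ℤ.+ + n ℤ.- + 1) /ℕ 2)) (toFin n ((i ℤ.+ j ℤ.+ + n ℤ.- + 1) /ℕ 2))
  entry≡partialEntry n A i j
    with toFin n ((j ℤ.- i ℤ.+ + n ℤ.- + 1) /ℕ 2) | toFin n ((i ℤ.+ j ℤ.+ + n ℤ.- + 1) /ℕ 2)
  ... | just r  | just c′ = refl
  ... | just r  | nothing = refl
  ... | nothing | _       = refl

  partialEntry-τ : ∀ {n} (A : Matrix n) r c′ → partialEntry (τA A) r c′ ≡ partialEntry A c′ r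
  partialEntry-τ A (just r) (just c′) = refl
  partialEntry-τ A (just r) nothing   = refl
  partialEntry-τ A nothing  (just c′) = refl
  partialEntry-τ A nothing  nothing   = refl

  partialEntry-σ : ∀ {n} (A : Matrix n) r c′ →
    partialEntry (σA A) r c′ ≡ partialEntry A (Maybe.map opposite c′) r
  partialEntry-σ A (just r) (just c′) = refl
  partialEntry-σ A (just r) nothing   = refl
  partialEntry-σ A nothing  (just c′) = refl
  partialEntry-σ A nothing  nothing   = refl

  entry-τ : ∀ n A i j → entry n (τA A) i j ≡ entry n A (ℤ.- i) j
  entry-τ n A i j = begin
    entry n (τA A) i j
      ≡⟨ entry≡partialEntry n (τA A) i j ⟩
    partialEntry (τA A) (index (j ℤ.- i)) (index (i ℤ.+ j))
      ≡⟨ partialEntry-τ A (index (j ℤ.- i)) (index (i ℤ.+ j)) ⟩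
    partialEntry A (index (i ℤ.+ j)) (index (j ℤ.- i))
      ≡⟨ cong₂ (λ x y → partialEntry A (index x) (index y)) (reflect-comm i j) (ℤₚ.+-comm j (ℤ.- i)) ⟩
    partialEntry A (index (j ℤ.- ℤ.- i)) (index (ℤ.- i ℤ.+ j))
      ≡⟨ entry≡partialEntry n A (ℤ.- i) j ⟨
    entry n A (ℤ.- i) j
      ∎
    where
    open ≡-Reasoning
    index : ℤ → Maybe (Fin n)
    index s = toFin n ((s ℤ.+ + n ℤ.- + 1) /ℕ 2)
    reflect-comm : ∀ i j → i ℤ.+ j ≡ j ℤ.- ℤ.- i
    reflect-comm = ℤSolver.solve-∀

  entry-σ : ∀ n A i j → Pyramid n i j 1 → entry n (σA A) i j ≡ entry n A j (ℤ.- i)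
  entry-σ n A i j p = begin
    entry n (σA A) i j
      ≡⟨ entry≡partialEntry n (σA A) i j ⟩
    partialEntry (σA A) (index (j ℤ.- i)) (index (i ℤ.+ j))
      ≡⟨ partialEntry-σ A (index (j ℤ.- i)) (index (i ℤ.+ j)) ⟩
    partialEntry A (Maybe.map opposite (index (i ℤ.+ j))) (index (j ℤ.- i))
      ≡⟨ cong (λ r → partialEntry A r (index (j ℤ.- i))) (toFin-opposite-layer₁ p) ⟨
    partialEntry A (index (ℤ.- i ℤ.- j)) (index (j ℤ.- i))
      ≡⟨ entry≡partialEntry n A j (ℤ.- i) ⟨
    entry n A j (ℤ.- i)
      ∎
    where
    open ≡-Reasoning
    index : ℤ → Maybe (Fin n)
    index s = toFin n ((s ℤ.+ + n ℤ.- + 1) /ℕ 2)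

  ldet-τ : ∀ n (A : Matrix n) λ' μ' → Generic n (τA A) (τλ λ' μ') (τμ λ' μ') →
    ldet n (τA A) (τλ λ' μ') (τμ λ' μ') ≈ ldet n A λ' μ'
  ldet-τ n A λ' μ' generic =
    agree-at-apex generic (λ i j _ → reflexive (entry-τ n A i j)) numerators
    where
    open Transport (τA A) A (τλ λ' μ') (τμ λ' μ') λ' μ' (λ i _ → ℤ.- i) (λ _ j → j)
    numerators : ∀ k i j → Pyramid n i j (suc (suc k)) → Agree (suc k) →
      numerator n (τA A) (τλ λ' μ') (τμ λ' μ') k i j ≈ numerator n A λ' μ' k (ℤ.- i) j
    numerators k i j p agree =
      +-cong (*-congˡ (*-cong (agree i _ (Pyramid-neighbourʲ inc p)) (agree i _ (Pyramid-neighbourʲ dec p))))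
             (*-congˡ (≈-trans (*-cong (agree _ j (Pyramid-neighbourⁱ inc p)) (agree _ j (Pyramid-neighbourⁱ dec p)))
                               (reflected-neighbours (λ x → T n A λ' μ' (suc k) x j) i)))

  ldet-σ : ∀ n (A : Matrix n) λ' μ' → Generic n (σA A) (σλ λ' μ') (σμ λ' μ') →
    ldet n (σA A) (σλ λ' μ') (σμ λ' μ') ≈ ldet n A λ' μ'
  ldet-σ n A λ' μ' generic =
    agree-at-apex generic (λ i j p → reflexive (entry-σ n A i j p)) numerators
    where
    open Transport (σA A) A (σλ λ' μ') (σμ λ' μ') λ' μ' (λ _ j → j) (λ i _ → ℤ.- i)
    numerators : ∀ k i j → Pyramid n i j (suc (suc k)) → Agree (suc k) →
      numerator n (σA A) (σλ λ' μ') (σμ λ' μ') k i j ≈ numerator n A λ' μ' k j (ℤ.- i)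
    numerators k i j p agree = ≈-trans
      (+-cong (*-congˡ (*-cong (agree i _ (Pyramid-neighbourʲ inc p)) (agree i _ (Pyramid-neighbourʲ dec p))))
              (*-congˡ (≈-trans (*-cong (agree _ j (Pyramid-neighbourⁱ inc p)) (agree _ j (Pyramid-neighbourⁱ dec p)))
                                (reflected-neighbours (T n A λ' μ' (suc k) j) i))))
      (+-comm _ _)

proposition3p5 : ∀ {c ℓ} (F : Field c ℓ) → let open Field F in let open LambdaDet F in
    (n : ℕ) → 1 ≤ n → (A : Matrix n) → (λ' μ' : ℤ → Carrier) →
    Generic n A λ' μ' →
    (Generic n (σA A) (σλ λ' μ') (σμ λ' μ') →
      ldet n (σA A) (σλ λ' μ') (σμ λ' μ') ≈ ldet n A λ' μ')
    × (Generic n (τA A) (τλ λ' μ') (τμ λ' μ') →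
      ldet n (τA A) (τλ λ' μ') (τμ λ' μ') ≈ ldet n A λ' μ')
proposition3p5 F n _ A λ' μ' _ = ldet-σ F n A λ' μ' , ldet-τ F n A λ' μ'
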